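{- Let $(E,\mathcal F,\mathcal L)$ be an oriented interval greedoid of rank $1$. Then $\mathcal L$ has exactly three elements $\mathbf 0,\beta,-\beta$, where $\mathbf 0$ is the unique element with support $\hat0$, and the Hasse diagram of $\mathcal L$ is $\mathbf 0<\beta$, $\mathbf 0<-\beta$ ($\beta,-\beta$ incomparable).
   Context: Interval greedoid: finite $E$, nonempty family $\mathcal F$ with (IG1) each nonempty $X\in\mathcal F$ has $x$ with $X\setminus\{x\}\in\mathcal F$; (IG2) if $|X|>|Y|$ there is $x\in X\setminus Y$ with $Y\cup\{x\}\in\mathcal F$; (IG3) if $X\subseteq Y\subseteq Z$ in $\mathcal F$, $e\notin Z$, $X\cup\{e\},Z\cup\{e\}\in\mathcal F$, then $Y\cup\{e\}\in\mathcal F$. $\Gamma(X)=\{x\in E\setminus X:X\cup\{x\}\in\mathcal F\}$; $X\sim Y$ iff $\Gamma(X)=\Gamma(Y)$; classes $[X]$ are flats; $\Phi$ the set of flats ordered by $[X]\le[Y]$ iff there is $Z\subseteq E\setminus Y$ with $Y\cup Z\in\mathcal F$ and $Y\cup Z\sim X$; $\Phi$ is a graded lattice with bottom $\hat0$ and top $[\emptyset]$. For a flat $A=[X]$: $\Gamma(A)=\Gamma(X)$, $\xi(A)=\bigcup_{X'\sim X}X'$; $\mu(S)=[X]$ for $X$ inclusion-maximal feasible in $S$; join $A\vee B=\mu(\xi(A)\cap\xi(B))$. A covector is $\alpha:E\to\{0,+,-,1\}$ such that for some flat $A=\mathrm{supp}(\alpha)$, $\alpha\in\{+,-\}$ on $\Gamma(A)$,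 $0$ on $\xi(A)$, $1$ elsewhere. Symbols ordered $0<+<1$, $0<-<1$; $\alpha\le\beta$ iff $\mathrm{supp}\,\alpha\le\mathrm{supp}\,\beta$ and they agree on $\Gamma(\mathrm{supp}\,\alpha)\cap\Gamma(\mathrm{supp}\,\beta)$. Product: with $C=\mathrm{supp}\,\alpha\vee\mathrm{supp}\,\beta$, $(\alpha\circ\beta)(e)=\beta(e)$ if $e\in\Gamma(C)\cup\xi(C)$ and $\beta(e)>\alpha(e)$; $\alpha(e)$ if $e\in\Gamma(C)\cup\xi(C)$ otherwise; $1$ otherwise. $-\alpha$ swaps $+,-$; $S(\alpha,\beta)=\{e:\alpha(e)=-\beta(e)\in\{+,-\}\}$. Oriented interval greedoid: $(E,\mathcal F,\mathcal L)$, $\mathcal L$ a set of covectors with (OG1) $\mathrm{supp}:\mathcal L\to\Phi$ surjective; (OG2) $-\mathcal L=\mathcal L$; (OG3) closed under $\circ$; (OG4) if $\alpha,\beta\in\mathcal L$, $x\in S(\alpha,\beta)$, $(\alpha\circ\beta)(x)\ne1$, some $\gamma\in\mathcal L$ has $\gamma(x)=0$ and $\gamma(y)=(\alpha\circ\beta)(y)=(\beta\circ\alpha)(y)$ for all $y\notin S(\alpha,\beta)$ with $(\alpha\circ\beta)(y)\neq1$. The rank of $(E,\mathcal F,\mathcal L)$ is the rank (length of a maximal chain) of $\Phi$. -}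

module Defs where

open import Data.Nat using (ℕ; _<_)
open import Data.Fin using (Fin)
open import Data.Fin.Subset
  using (Subset; _∈_; _∉_; _⊆_; _∪_; _-_; ⁅_⁆; ∣_∣; ∁)
  renaming (⊥ to ∅)
open import Data.Vec using (Vec; lookup; map)
open import Data.Product using (Σ; ∃; ∃-syntax; _×_; _,_)
open import Data.Sum using (_⊎_)
open import Data.Empty using (⊥)
open import Relation.Nullary using (¬_)
open import Relation.Binary.PropositionalEquality using (_≡_; _≢_)

-- Ground set E = Fin n, subsets of E = Subset n (bit vectors),
-- a family of subsets is a predicate on Subset n.

Family : ℕ → Set₁
Family n = Subset n → Set

module _ {n : ℕ} (F : Family n) where

  _∈Γ_ : Fin n → Subset n → Set
  e ∈Γ X = (e ∉ X) × F (X ∪ ⁅ e ⁆)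

  _∼_ : Subset n → Subset n → Set
  X ∼ Y = ∀ e → ((e ∈Γ X → e ∈Γ Y) × (e ∈Γ Y → e ∈Γ X))

  _∈ξ_ : Fin n → Subset n → Set
  e ∈ξ X = ∃[ X' ] (F X' × X' ∼ X × e ∈ X')

  -- order on flats (flats represented by feasible representatives):
  -- [X] ≤ [Y] iff ∃ Z ⊆ E ∖ Y with Y ∪ Z ∈ F and Y ∪ Z ∼ X
  FlatLe : Subset n → Subset n → Set
  FlatLe X Y = ∃[ Z ] (Z ⊆ ∁ Y × F (Y ∪ Z) × (Y ∪ Z) ∼ X)

  IsBottomFlat : Subset n → Set
  IsBottomFlat X = F X × (∀ Y → F Y → FlatLe X Y)

  Comparable : Subset n → Subset n → Set
  Comparable C A = FlatLe C A ⊎ FlatLe A C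

  -- Φ has rank 1: there is a maximal chain [A₀] < [A₁] of length 1
  RankOne : Set
  RankOne = ∃[ A₀ ] ∃[ A₁ ] (F A₀ × F A₁ × FlatLe A₀ A₁ × ¬ (A₀ ∼ A₁)
            × (∀ C → F C → Comparable C A₀ → Comparable C A₁ → (C ∼ A₀) ⊎ (C ∼ A₁)))

  -- W is inclusion-maximal feasible inside ξ([X]) ∩ ξ([Y]);
  -- then [W] = μ(ξ[X] ∩ ξ[Y]) = [X] ∨ [Y]
  JoinRep : Subset n → Subset n → Subset n → Set
  JoinRep X Y W = F W × (∀ e → e ∈ W → (e ∈ξ X × e ∈ξ Y))
    × (∀ W' → F W' → W ⊆ W' → (∀ e → e ∈ W' → (e ∈ξ X × e ∈ξ Y)) → W' ≡ W)

record IsIntervalGreedoid {n : ℕ} (F : Family n) : Set where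
  field
    nonempty : ∃[ X ] F X
    IG1 : ∀ X → F X → X ≢ ∅ → ∃[ x ] (x ∈ X × F (X - x))
    IG2 : ∀ X Y → F X → F Y → ∣ Y ∣ < ∣ X ∣ → ∃[ x ] (x ∈ X × x ∉ Y × F (Y ∪ ⁅ x ⁆))
    IG3 : ∀ X Y Z e → F X → F Y → F Z → X ⊆ Y → Y ⊆ Z → e ∉ Z
          → F (X ∪ ⁅ e ⁆) → F (Z ∪ ⁅ e ⁆) → F (Y ∪ ⁅ e ⁆)

data Sym : Set where
  𝟎 ⊕ ⊖ 𝟏 : Sym

data _<ˢ_ : Sym → Sym → Set where
  0<+ : 𝟎 <ˢ ⊕
  0<- : 𝟎 <ˢ ⊖
  0<1 : 𝟎 <ˢ 𝟏
  +<1 : ⊕ <ˢ 𝟏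
  -<1 : ⊖ <ˢ 𝟏

negˢ : Sym → Sym
negˢ 𝟎 = 𝟎
negˢ ⊕ = ⊖
negˢ ⊖ = ⊕
negˢ 𝟏 = 𝟏

SignVec : ℕ → Set
SignVec n = Vec Sym n

neg : ∀ {n} → SignVec n → SignVec n
neg = map negˢ


IsPM : Sym → Set
IsPM s = (s ≡ ⊕) ⊎ (s ≡ ⊖)

module _ {n : ℕ} (F : Family n) where

  -- Supp α X : α is a covector whose support is the flat [X]
  -- (α ∈ {+,-} on Γ[X], 0 on ξ[X], 1 elsewhere)
  Supp : SignVec n → Subset n → Set
  Supp α X = F X × (∀ e → (_∈Γ_ F e X → IsPM (lookup α e))
                        × (_∈ξ_ F e X → lookup α e ≡ 𝟎)
                        × (¬ (_∈Γ_ F e X) → ¬ (_∈ξ_ F e X) → lookup α e ≡ 𝟏))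

  IsCovector : SignVec n → Set
  IsCovector α = ∃[ X ] Supp α X

  CovLe : SignVec n → SignVec n → Set
  CovLe α β = ∃[ X ] ∃[ Y ] (Supp α X × Supp β Y × FlatLe F X Y
              × (∀ e → _∈Γ_ F e X → _∈Γ_ F e Y → lookup α e ≡ lookup β e))

  Prod : SignVec n → SignVec n → SignVec n → Set
  Prod α β γ = ∃[ X ] ∃[ Y ] ∃[ W ] (Supp α X × Supp β Y × JoinRep F X Y W
     × (∀ e → ((_∈Γ_ F e W ⊎ _∈ξ_ F e W) →
                  ((lookup α e <ˢ lookup β e → lookup γ e ≡ lookup β e)
                   × (¬ (lookup α e <ˢ lookup β e) → lookup γ e ≡ lookup α e)))
            × (¬ (_∈Γ_ F e W ⊎ _∈ξ_ F e W) → lookup γ e ≡ 𝟏)))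

  Sep : SignVec n → SignVec n → Fin n → Set
  Sep α β e = (lookup α e ≡ negˢ (lookup β e)) × IsPM (lookup α e)

record IsOrientedIntervalGreedoid {n : ℕ} (F : Family n) (L : SignVec n → Set) : Set where
  field
    greedoid : IsIntervalGreedoid F
    covectors : ∀ α → L α → IsCovector F α
    OG1 : ∀ X → F X → ∃[ α ] (L α × Supp F α X)
    OG2 : ∀ α → L α → L (neg α)
    OG3 : ∀ α β γ → L α → L β → Prod F α β γ → L γ
    OG4 : ∀ α β x → L α → L β → Sep F α β x →
          ∀ p q → Prod F α β p → Prod F β α q → lookup p x ≢ 𝟏 →
          ∃[ γ ] (L γ × lookup γ x ≡ 𝟎
                  × (∀ y → ¬ Sep F α β y → lookup p y ≢ 𝟏 →
                       (lookup γ y ≡ lookup p y) × (lookup p y ≡ lookup q y)))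

-- In rank one the only flats are the bottom 0̂ and the top [∅]. Every nonempty
-- feasible set lies in 0̂, and Γ(0̂) = ∅, so a covector supported on 0̂ is 0 on
-- ξ(0̂) and 1 elsewhere: it is the unique covector 𝟎. A covector supported on
-- [∅] is a sign vector on Γ(∅) and 1 off it. If two such covectors γ, β were
-- neither equal nor opposite, they would separate at some e and agree at some
-- e′; elimination (OG4) at e then yields a covector that is 0 at e ∈ Γ(∅) yet
-- signed at e′, which neither 𝟎 nor a top covector can be.
module Submission where

open import Defs
open import Data.Nat using (ℕ; _<_)
open import Data.Nat.Induction using (<-wellFounded)
open import Data.Fin using (Fin)
open import Data.Fin.Subset
  using (Subset; _∈_; _∉_; _⊆_; _⊂_; _∪_; _-_; ⁅_⁆; ∣_∣; ∁; Nonempty)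
  renaming (⊥ to ∅)
open import Data.Fin.Subset.Properties
  using ( ∉⊥; ⊥⊆; nonempty?; Empty-unique; x∈⁅x⁆; x∈⁅y⁆⇒x≡y; x∉p⇒x∈∁p
        ; p⊆p∪q; q⊆p∪q; x∈p∪q⁻; ∪-identityˡ; ∪-identityʳ; ∪-assoc
        ; p⊂q⇒∣p∣<∣q∣; p⊂q⇒∁p⊃∁q; p⊆q⇒∁p⊇∁q; x∈p⇒∣p-x∣<∣p∣ )
open import Data.Vec using (Vec; lookup; tabulate)
open import Data.Vec.Properties using (lookup-map; ≡-dec; tabulate∘lookup; tabulate-cong)
open import Data.Product using (∃; ∃-syntax; _×_; _,_; proj₁; proj₂)
open import Data.Sum using (_⊎_; inj₁; inj₂; [_,_])
open import Data.Empty using (⊥; ⊥-elim)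
open import Function using (_∘_; id)
open import Induction.WellFounded using (Acc; acc)
open import Relation.Binary.Definitions using (DecidableEquality)
open import Relation.Nullary using (¬_; yes; no)
open import Relation.Nullary.Decidable using (decidable-stable; ¬¬-excluded-middle)
open import Relation.Binary.PropositionalEquality
  using (_≡_; _≢_; refl; sym; trans; cong; subst; module ≡-Reasoning)

_≟ˢ_ : DecidableEquality Sym
𝟎 ≟ˢ 𝟎 = yes refl
𝟎 ≟ˢ ⊕ = no λ ()
𝟎 ≟ˢ ⊖ = no λ ()
𝟎 ≟ˢ 𝟏 = no λ ()
⊕ ≟ˢ 𝟎 = no λ ()
⊕ ≟ˢ ⊕ = yes refl
⊕ ≟ˢ ⊖ = no λ ()
⊕ ≟ˢ 𝟏 = no λ ()
⊖ ≟ˢ 𝟎 = no λ ()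
⊖ ≟ˢ ⊕ = no λ ()
⊖ ≟ˢ ⊖ = yes refl
⊖ ≟ˢ 𝟏 = no λ ()
𝟏 ≟ˢ 𝟎 = no λ ()
𝟏 ≟ˢ ⊕ = no λ ()
𝟏 ≟ˢ ⊖ = no λ ()
𝟏 ≟ˢ 𝟏 = yes refl

negˢ-involutive : ∀ s → negˢ (negˢ s) ≡ s
negˢ-involutive 𝟎 = refl
negˢ-involutive ⊕ = refl
negˢ-involutive ⊖ = refl
negˢ-involutive 𝟏 = refl

IsPM⇒≢𝟎 : ∀ {s} → IsPM s → s ≢ 𝟎
IsPM⇒≢𝟎 (inj₁ refl) ()
IsPM⇒≢𝟎 (inj₂ refl) ()

IsPM⇒≢𝟏 : ∀ {s} → IsPM s → s ≢ 𝟏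
IsPM⇒≢𝟏 (inj₁ refl) ()
IsPM⇒≢𝟏 (inj₂ refl) ()

IsPM⇒≢negˢ : ∀ {s} → IsPM s → s ≢ negˢ s
IsPM⇒≢negˢ (inj₁ refl) ()
IsPM⇒≢negˢ (inj₂ refl) ()

IsPM-negˢ : ∀ {s} → IsPM s → IsPM (negˢ s)
IsPM-negˢ (inj₁ refl) = inj₂ refl
IsPM-negˢ (inj₂ refl) = inj₁ refl

IsPM⇒≡⊎≡negˢ : ∀ {s t} → IsPM s → IsPM t → s ≡ t ⊎ s ≡ negˢ t
IsPM⇒≡⊎≡negˢ (inj₁ refl) (inj₁ refl) = inj₁ refl
IsPM⇒≡⊎≡negˢ (inj₁ refl) (inj₂ refl) = inj₂ refl
IsPM⇒≡⊎≡negˢ (inj₂ refl) (inj₁ refl) = inj₂ refl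
IsPM⇒≡⊎≡negˢ (inj₂ refl) (inj₂ refl) = inj₁ refl

IsPM⇒¬<ˢ : ∀ {s t} → IsPM s → IsPM t → ¬ (s <ˢ t)
IsPM⇒¬<ˢ (inj₁ refl) (inj₁ refl) ()
IsPM⇒¬<ˢ (inj₁ refl) (inj₂ refl) ()
IsPM⇒¬<ˢ (inj₂ refl) (inj₁ refl) ()
IsPM⇒¬<ˢ (inj₂ refl) (inj₂ refl) ()

lookup-ext : ∀ {A : Set} {m} {u v : Vec A m} → (∀ i → lookup u i ≡ lookup v i) → u ≡ v
lookup-ext {u = u} {v} u≗v = begin
  u                  ≡⟨ sym (tabulate∘lookup u) ⟩
  tabulate (lookup u) ≡⟨ tabulate-cong u≗v ⟩
  tabulate (lookup v) ≡⟨ tabulate∘lookup v ⟩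
  v                  ∎
  where open ≡-Reasoning

lookup-neg : ∀ {m} (α : SignVec m) e → lookup (neg α) e ≡ negˢ (lookup α e)
lookup-neg α e = lookup-map e negˢ α

module _ {n : ℕ} where

  private variable
    X Y : Subset n
    e : Fin n

  nonempty⇒≢∅ : Nonempty X → X ≢ ∅
  nonempty⇒≢∅ (x , x∈X) X≡∅ = ∉⊥ (subst (x ∈_) X≡∅ x∈X)

  ∪≡∅⇒≡∅ : X ∪ Y ≡ ∅ → X ≡ ∅
  ∪≡∅⇒≡∅ {Y = Y} X∪Y≡∅ = Empty-unique λ (x , x∈X) → ∉⊥ (subst (x ∈_) X∪Y≡∅ (p⊆p∪q Y x∈X))

  x∈p∪⁅x⁆ : e ∈ X ∪ ⁅ e ⁆
  x∈p∪⁅x⁆ {e} {X} = q⊆p∪q X ⁅ e ⁆ (x∈⁅x⁆ e)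

  ⊂-∪⁅⁆ : e ∉ X → X ⊂ X ∪ ⁅ e ⁆
  ⊂-∪⁅⁆ {e} e∉X = p⊆p∪q ⁅ e ⁆ , e , x∈p∪⁅x⁆ , e∉X

  ⁅⁆⊆∁ : e ∉ X → ⁅ e ⁆ ⊆ ∁ X
  ⁅⁆⊆∁ {e} {X} e∉X x∈⁅e⁆ = x∉p⇒x∈∁p (subst (_∉ X) (sym (x∈⁅y⁆⇒x≡y e x∈⁅e⁆)) e∉X)

  ⁅⁆∪⊆∁ : e ∉ X → Y ⊆ ∁ (X ∪ ⁅ e ⁆) → ⁅ e ⁆ ∪ Y ⊆ ∁ X
  ⁅⁆∪⊆∁ {e} {Y = Y} e∉X Y⊆∁X+e x∈⁅e⁆∪Y =
    [ ⁅⁆⊆∁ e∉X , p⊆q⇒∁p⊇∁q (p⊆p∪q ⁅ e ⁆) ∘ Y⊆∁X+e ] (x∈p∪q⁻ ⁅ e ⁆ Y x∈⁅e⁆∪Y)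

module Greedoid {n : ℕ} (F : Family n) where

  Γ : Subset n → Fin n → Set
  Γ X e = _∈Γ_ F e X

  ξ : Subset n → Fin n → Set
  ξ X e = _∈ξ_ F e X

  infix 4 _≈_
  _≈_ : Subset n → Subset n → Set
  _≈_ = _∼_ F

  private variable
    X Y C : Subset n
    e e′ : Fin n

  ≈-refl : X ≈ X
  ≈-refl _ = id , id

  ≈-sym : X ≈ Y → Y ≈ X
  ≈-sym X≈Y e = proj₂ (X≈Y e) , proj₁ (X≈Y e)

  ≈-trans : X ≈ Y → Y ≈ C → X ≈ C
  ≈-trans X≈Y Y≈C e = proj₁ (Y≈C e) ∘ proj₁ (X≈Y e) , proj₂ (X≈Y e) ∘ proj₂ (Y≈C e)

  ≡⇒≈ : X ≡ Y → X ≈ Y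
  ≡⇒≈ refl = ≈-refl

  ξ-resp-≈ : X ≈ Y → ξ X e → ξ Y e
  ξ-resp-≈ X≈Y (X′ , fX′ , X′≈X , e∈X′) = X′ , fX′ , ≈-trans X′≈X X≈Y , e∈X′

  Γ-empty⇒≈ : (∀ e → ¬ Γ X e) → (∀ e → ¬ Γ Y e) → X ≈ Y
  Γ-empty⇒≈ ¬ΓX ¬ΓY e = ⊥-elim ∘ ¬ΓX e , ⊥-elim ∘ ¬ΓY e

  FlatLe-respˡ-≈ : X ≈ Y → FlatLe F X C → FlatLe F Y C
  FlatLe-respˡ-≈ X≈Y (Z , Z⊆∁C , fC∪Z , C∪Z≈X) = Z , Z⊆∁C , fC∪Z , ≈-trans C∪Z≈X X≈Y

  ≈⇒FlatLe : F Y → Y ≈ X → FlatLe F X Y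
  ≈⇒FlatLe {Y} fY Y≈X =
    ∅ , ⊥⊆ , subst F (sym (∪-identityʳ Y)) fY , ≈-trans (≡⇒≈ (∪-identityʳ Y)) Y≈X

  FlatLe-top : F X → FlatLe F X ∅
  FlatLe-top {X} fX =
    X , (λ _ → x∉p⇒x∈∁p ∉⊥) , subst F (sym (∪-identityˡ X)) fX , ≡⇒≈ (∪-identityˡ X)

  IsSaturation : Subset n → Subset n → Set
  IsSaturation X Z = Z ⊆ ∁ X × F (X ∪ Z) × (∀ e → ¬ Γ (X ∪ Z) e)

  -- Finiteness alone lets a feasible set be extended until Γ is empty; the
  -- double negation is needed because membership in Γ is not decidable.
  ¬¬-saturation : F X → ¬ ¬ ∃ (IsSaturation X)
  ¬¬-saturation fX = extend _ (<-wellFounded _) fX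
    where
    extend : ∀ X → Acc _<_ ∣ ∁ X ∣ → F X → ¬ ¬ ∃ (IsSaturation X)
    extend X (acc smaller) fX done = ¬¬-excluded-middle {A = ∃ (Γ X)} λ where
      (no ∄e) → done (∅ , ⊥⊆ , subst F (sym (∪-identityʳ X)) fX ,
                      λ e e∈Γ → ∄e (e , subst (λ W → Γ W e) (∪-identityʳ X) e∈Γ))
      (yes (e , e∉X , fX+e)) →
        extend (X ∪ ⁅ e ⁆) (smaller (p⊂q⇒∣p∣<∣q∣ (p⊂q⇒∁p⊃∁q (⊂-∪⁅⁆ e∉X)))) fX+e
          λ (Z , Z⊆∁X+e , fX+e∪Z , saturated) →
            done ( ⁅ e ⁆ ∪ Z
                 , ⁅⁆∪⊆∁ e∉X Z⊆∁X+e
                 , subst F (∪-assoc X ⁅ e ⁆ Z) fX+e∪Z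
                 , λ e′ → saturated e′ ∘ subst (λ W → Γ W e′) (sym (∪-assoc X ⁅ e ⁆ Z)) )

  Supp-Γ : ∀ α → Supp F α X → Γ X e → IsPM (lookup α e)
  Supp-Γ {e = e} _ (_ , s) = proj₁ (s e)

  Supp-ξ : ∀ α → Supp F α X → ξ X e → lookup α e ≡ 𝟎
  Supp-ξ {e = e} _ (_ , s) = proj₁ (proj₂ (s e))

  Supp-else : ∀ α → Supp F α X → ¬ Γ X e → ¬ ξ X e → lookup α e ≡ 𝟏
  Supp-else {e = e} _ (_ , s) = proj₂ (proj₂ (s e))

  Supp-neg : ∀ α → Supp F α X → Supp F (neg α) X
  Supp-neg α (fX , s) = fX , λ e →
      (λ e∈Γ → subst IsPM (sym (lookup-neg α e)) (IsPM-negˢ (proj₁ (s e) e∈Γ)))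
    , (λ e∈ξ → trans (lookup-neg α e) (cong negˢ (proj₁ (proj₂ (s e)) e∈ξ)))
    , (λ e∉Γ e∉ξ → trans (lookup-neg α e) (cong negˢ (proj₂ (proj₂ (s e)) e∉Γ e∉ξ)))

  Supp-IsPM⇒¬¬Γ : ∀ α → Supp F α X → IsPM (lookup α e) → ¬ ¬ Γ X e
  Supp-IsPM⇒¬¬Γ α S pm e∉Γ = IsPM⇒≢𝟏 pm (Supp-else α S e∉Γ (IsPM⇒≢𝟎 pm ∘ Supp-ξ α S))

  Supp-≢neg : ∀ α → Supp F α X → Γ X e → α ≢ neg α
  Supp-≢neg {e = e} α S e∈Γ α≡-α =
    IsPM⇒≢negˢ (Supp-Γ α S e∈Γ) (trans (cong (λ v → lookup v e) α≡-α) (lookup-neg α e))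

  Supp-agree-off-Γ : ∀ α γ → Supp F α X → Supp F γ Y → X ≈ Y → ¬ Γ X e → lookup α e ≡ lookup γ e
  Supp-agree-off-Γ {X = X} {e = e} α γ Sα Sγ X≈Y e∉Γ =
    decidable-stable (_ ≟ˢ _) λ αe≢γe → ¬¬-excluded-middle {A = ξ X e} λ where
      (yes e∈ξ) → αe≢γe (trans (Supp-ξ α Sα e∈ξ) (sym (Supp-ξ γ Sγ (ξ-resp-≈ X≈Y e∈ξ))))
      (no e∉ξ) → αe≢γe (trans (Supp-else α Sα e∉Γ e∉ξ)
                        (sym (Supp-else γ Sγ (e∉Γ ∘ proj₂ (X≈Y e)) (e∉ξ ∘ ξ-resp-≈ (≈-sym X≈Y)))))

  differ⇒¬¬Sep : ∀ γ δ → Supp F γ X → Supp F δ X → lookup γ e ≢ lookup δ e → ¬ ¬ Sep F γ δ e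
  differ⇒¬¬Sep γ δ Sγ Sδ γe≢δe ¬sep = γe≢δe (Supp-agree-off-Γ γ δ Sγ Sδ ≈-refl λ e∈Γ →
    [ γe≢δe , (λ γe≡-δe → ¬sep (γe≡-δe , Supp-Γ γ Sγ e∈Γ)) ]
      (IsPM⇒≡⊎≡negˢ (Supp-Γ γ Sγ e∈Γ) (Supp-Γ δ Sδ e∈Γ)))

  module IntervalGreedoid (G : IsIntervalGreedoid F) where
    open IsIntervalGreedoid G

    feasible-∅ : F ∅
    feasible-∅ = descend _ (<-wellFounded _) (proj₂ nonempty)
      where
      descend : ∀ X → Acc _<_ ∣ X ∣ → F X → F ∅
      descend X (acc smaller) fX with nonempty? X
      ... | no X-empty = subst F (Empty-unique X-empty) fX
      ... | yes X-nonempty with IG1 X fX (nonempty⇒≢∅ X-nonempty)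
      ...   | y , y∈X , fX-y = descend (X - y) (smaller (x∈p⇒∣p-x∣<∣p∣ y∈X)) fX-y

    -- IG2 against ∅ puts an element of X into Γ(∅), but never into Γ(X).
    nonempty⇒≉∅ : F X → Nonempty X → ¬ X ≈ ∅
    nonempty⇒≉∅ {X} fX (x , x∈X) X≈∅ with IG2 X ∅ fX feasible-∅ (p⊂q⇒∣p∣<∣q∣ (⊥⊆ , x , x∈X , ∉⊥))
    ... | y , y∈X , y∉∅ , f⁅y⁆ = proj₁ (proj₂ (X≈∅ y) (y∉∅ , f⁅y⁆)) y∈X

    ≈∅⇒≡∅ : F X → X ≈ ∅ → X ≡ ∅
    ≈∅⇒≡∅ {X} fX X≈∅ with nonempty? X
    ... | yes X-nonempty = ⊥-elim (nonempty⇒≉∅ fX X-nonempty X≈∅)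
    ... | no X-empty = Empty-unique X-empty

    ξ-∅-empty : ¬ ξ ∅ e
    ξ-∅-empty {e} (X , fX , X≈∅ , e∈X) = nonempty⇒≉∅ fX (e , e∈X) X≈∅

    FlatLe-from-top : FlatLe F ∅ Y → Y ≡ ∅
    FlatLe-from-top (Z , _ , fY∪Z , Y∪Z≈∅) = ∪≡∅⇒≡∅ (≈∅⇒≡∅ fY∪Z Y∪Z≈∅)

    JoinRep-top : JoinRep F ∅ ∅ ∅
    JoinRep-top =
        feasible-∅
      , (λ _ e∈∅ → ⊥-elim (∉⊥ e∈∅))
      , λ W _ _ W⊆ξ → Empty-unique λ (x , x∈W) → ξ-∅-empty (proj₁ (W⊆ξ x x∈W))

    Prod-top : ∀ α γ → Supp F α ∅ → Supp F γ ∅ → Prod F α γ α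
    Prod-top α γ Sα Sγ = ∅ , ∅ , ∅ , Sα , Sγ , JoinRep-top , λ e →
        (λ e∈Γ⊎ξ → (λ α<γ → ⊥-elim (incomparable e∈Γ⊎ξ α<γ)) , λ _ → refl)
      , λ e∉Γ⊎ξ → Supp-else α Sα (e∉Γ⊎ξ ∘ inj₁) ξ-∅-empty
      where
      incomparable : Γ ∅ e ⊎ ξ ∅ e → ¬ (lookup α e <ˢ lookup γ e)
      incomparable (inj₁ e∈Γ) = IsPM⇒¬<ˢ (Supp-Γ α Sα e∈Γ) (Supp-Γ γ Sγ e∈Γ)
      incomparable (inj₂ e∈ξ) _ = ξ-∅-empty e∈ξ

  module OrientedIntervalGreedoid {L : SignVec n → Set} (OG : IsOrientedIntervalGreedoid F L) where
    open IsOrientedIntervalGreedoid OG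
    open IntervalGreedoid greedoid

    eliminate-top : ∀ {α γ} → L α → L γ → Supp F α ∅ → Supp F γ ∅ → Sep F α γ e
      → IsPM (lookup α e′) → lookup α e′ ≡ lookup γ e′
      → ∃[ δ ] (L δ × lookup δ e ≡ 𝟎 × lookup δ e′ ≡ lookup α e′)
    eliminate-top {e} {e′} {α} {γ} α∈L γ∈L Sα Sγ sep pm αe′≡γe′
      with OG4 α γ e α∈L γ∈L sep α γ (Prod-top α γ Sα Sγ) (Prod-top γ α Sγ Sα) (IsPM⇒≢𝟏 (proj₂ sep))
    ... | δ , δ∈L , δe≡𝟎 , δ≡α∘γ = δ , δ∈L , δe≡𝟎 , proj₁ (δ≡α∘γ e′ ¬sep (IsPM⇒≢𝟏 pm))
      where
      ¬sep : ¬ Sep F α γ e′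
      ¬sep (αe′≡-γe′ , _) = IsPM⇒≢negˢ pm (trans αe′≡-γe′ (cong negˢ (sym αe′≡γe′)))

  module RankOneFlats
    (G : IsIntervalGreedoid F) {A₀ A₁ : Subset n} (fA₀ : F A₀) (fA₁ : F A₁)
    (A₀≤A₁ : FlatLe F A₀ A₁) (A₀≉A₁ : ¬ A₀ ≈ A₁)
    (maximal : ∀ C → F C → Comparable F C A₀ → Comparable F C A₁ → C ≈ A₀ ⊎ C ≈ A₁)
    where
    open IntervalGreedoid G

    A₁≡∅ : A₁ ≡ ∅
    A₁≡∅ with maximal ∅ feasible-∅ (inj₂ (FlatLe-top fA₀)) (inj₂ (FlatLe-top fA₁))
    ... | inj₂ ∅≈A₁ = ≈∅⇒≡∅ fA₁ (≈-sym ∅≈A₁)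
    ... | inj₁ ∅≈A₀ = ⊥-elim (A₀≉A₁ (≡⇒≈ (trans A₀≡∅ (sym A₁≡∅′))))
      where
      A₀≡∅ : A₀ ≡ ∅
      A₀≡∅ = ≈∅⇒≡∅ fA₀ (≈-sym ∅≈A₀)
      A₁≡∅′ : A₁ ≡ ∅
      A₁≡∅′ = FlatLe-from-top (FlatLe-respˡ-≈ (≈-sym ∅≈A₀) A₀≤A₁)

    A₀-nonempty : Nonempty A₀
    A₀-nonempty with nonempty? A₀
    ... | yes witness = witness
    ... | no A₀-empty = ⊥-elim (A₀≉A₁ (≡⇒≈ (trans (Empty-unique A₀-empty) (sym A₁≡∅))))

    comparable-A₀⇒≈A₀⊎≡∅ : F C → Comparable F C A₀ → C ≈ A₀ ⊎ C ≡ ∅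
    comparable-A₀⇒≈A₀⊎≡∅ fC C~A₀
      with maximal _ fC C~A₀ (inj₁ (subst (FlatLe F _) (sym A₁≡∅) (FlatLe-top fC)))
    ... | inj₁ C≈A₀ = inj₁ C≈A₀
    ... | inj₂ C≈A₁ = inj₂ (≈∅⇒≡∅ fC (≈-trans C≈A₁ (≡⇒≈ A₁≡∅)))

    Γ-A₀-empty : ¬ Γ A₀ e
    Γ-A₀-empty {e} (e∉A₀ , fA₀+e)
      with comparable-A₀⇒≈A₀⊎≡∅ fA₀+e (inj₁ (⁅ e ⁆ , ⁅⁆⊆∁ e∉A₀ , fA₀+e , ≈-refl))
    ... | inj₁ A₀+e≈A₀ = proj₁ (proj₂ (A₀+e≈A₀ e) (e∉A₀ , fA₀+e)) x∈p∪⁅x⁆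
    ... | inj₂ A₀+e≡∅ = nonempty⇒≢∅ (e , x∈p∪⁅x⁆) A₀+e≡∅

    -- A saturation X ∪ Z of X has Γ = ∅ like A₀, so [A₀] ≤ [X];
    -- maximality of the chain then leaves only [X] = [A₀].
    Γ-nonempty-empty : F X → Nonempty X → ¬ Γ X e
    Γ-nonempty-empty {X} {e} fX X-nonempty e∈ΓX =
      ¬¬-saturation fX λ (Z , Z⊆∁X , fX∪Z , saturated) →
        [ (λ X≈A₀ → Γ-A₀-empty (proj₁ (X≈A₀ e) e∈ΓX))
        , nonempty⇒≢∅ X-nonempty ]
        (comparable-A₀⇒≈A₀⊎≡∅ fX
          (inj₂ (Z , Z⊆∁X , fX∪Z , Γ-empty⇒≈ saturated (λ _ → Γ-A₀-empty))))

    nonempty⇒≈A₀ : F X → Nonempty X → X ≈ A₀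
    nonempty⇒≈A₀ fX X-nonempty =
      Γ-empty⇒≈ (λ _ → Γ-nonempty-empty fX X-nonempty) (λ _ → Γ-A₀-empty)

    Γ-∅-nonempty : ¬ (∀ e → ¬ Γ ∅ e)
    Γ-∅-nonempty Γ-∅-empty =
      nonempty⇒≉∅ fA₀ A₀-nonempty (Γ-empty⇒≈ (λ _ → Γ-A₀-empty) Γ-∅-empty)

    A₀-bottom : IsBottomFlat F A₀
    A₀-bottom = fA₀ , A₀≤
      where
      A₀≤ : ∀ Y → F Y → FlatLe F A₀ Y
      A₀≤ Y fY with nonempty? Y
      ... | yes Y-nonempty = ≈⇒FlatLe fY (nonempty⇒≈A₀ fY Y-nonempty)
      ... | no Y-empty = subst (FlatLe F A₀) (sym (Empty-unique Y-empty)) (FlatLe-top fA₀)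

    module Covectors {L : SignVec n → Set} (OG : IsOrientedIntervalGreedoid F L) where
      open IsOrientedIntervalGreedoid OG
      open OrientedIntervalGreedoid OG

      z : SignVec n
      z = proj₁ (OG1 A₀ fA₀)

      z∈L : L z
      z∈L = proj₁ (proj₂ (OG1 A₀ fA₀))

      z-supp : Supp F z A₀
      z-supp = proj₂ (proj₂ (OG1 A₀ fA₀))

      β : SignVec n
      β = proj₁ (OG1 A₁ fA₁)

      β∈L : L β
      β∈L = proj₁ (proj₂ (OG1 A₁ fA₁))

      β-supp : Supp F β ∅
      β-supp = subst (Supp F β) A₁≡∅ (proj₂ (proj₂ (OG1 A₁ fA₁)))

      z-¬IsPM : ¬ IsPM (lookup z e)
      z-¬IsPM pm = Supp-IsPM⇒¬¬Γ z z-supp pm Γ-A₀-empty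

      Supp-nonempty⇒≡z : ∀ γ → Supp F γ X → Nonempty X → γ ≡ z
      Supp-nonempty⇒≡z γ Sγ X-nonempty = lookup-ext λ e →
        Supp-agree-off-Γ γ z Sγ z-supp (nonempty⇒≈A₀ (proj₁ Sγ) X-nonempty)
          (Γ-nonempty-empty (proj₁ Sγ) X-nonempty)

      support-cases : ∀ γ → Supp F γ X → γ ≡ z ⊎ X ≡ ∅
      support-cases {X = X} γ Sγ with nonempty? X
      ... | yes X-nonempty = inj₁ (Supp-nonempty⇒≡z γ Sγ X-nonempty)
      ... | no X-empty = inj₂ (Empty-unique X-empty)

      Supp-∅⇒≢z : ∀ γ → Supp F γ ∅ → γ ≢ z
      Supp-∅⇒≢z γ Sγ refl = Γ-∅-nonempty λ e e∈Γ → z-¬IsPM (Supp-Γ γ Sγ e∈Γ)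

      signed⇒≢𝟎-on-Γ∅ : ∀ {δ} → L δ → IsPM (lookup δ e′) → Γ ∅ e → lookup δ e ≢ 𝟎
      signed⇒≢𝟎-on-Γ∅ {δ = δ} δ∈L pm e∈Γ with covectors δ δ∈L
      ... | X , Sδ with support-cases δ Sδ
      ...   | inj₁ refl = ⊥-elim (z-¬IsPM pm)
      ...   | inj₂ refl = IsPM⇒≢𝟎 (Supp-Γ δ Sδ e∈Γ)

      sign-clash : ∀ {γ δ} → L γ → L δ → Supp F γ ∅ → Supp F δ ∅ → Sep F γ δ e
        → IsPM (lookup γ e′) → lookup γ e′ ≡ lookup δ e′ → ⊥
      sign-clash {γ = γ} γ∈L δ∈L Sγ Sδ sep pm γe′≡δe′
        with eliminate-top γ∈L δ∈L Sγ Sδ sep pm γe′≡δe′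
      ... | ε , ε∈L , εe≡𝟎 , εe′≡γe′ = Supp-IsPM⇒¬¬Γ γ Sγ (proj₂ sep) λ e∈Γ →
        signed⇒≢𝟎-on-Γ∅ ε∈L (subst IsPM (sym εe′≡γe′) pm) e∈Γ εe≡𝟎

      top-covectors : ∀ {γ} → L γ → Supp F γ ∅ → γ ≡ β ⊎ γ ≡ neg β
      top-covectors {γ} γ∈L Sγ with ≡-dec _≟ˢ_ γ (neg β)
      ... | yes γ≡-β = inj₂ γ≡-β
      ... | no γ≢-β = inj₁ (lookup-ext λ e → decidable-stable (_ ≟ˢ _) λ γe≢βe →
            γ≢-β (lookup-ext λ e′ → decidable-stable (_ ≟ˢ _) λ γe′≢-βe′ →
              differ⇒¬¬Sep γ β Sγ β-supp γe≢βe λ e-sep →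
              differ⇒¬¬Sep γ (neg β) Sγ (Supp-neg β β-supp) γe′≢-βe′ λ e′-sep →
                sign-clash γ∈L β∈L Sγ β-supp e-sep (proj₂ e′-sep) (agree e′-sep)))
        where
        agree : Sep F γ (neg β) e′ → lookup γ e′ ≡ lookup β e′
        agree {e′} (γe′≡--βe′ , _) =
          trans γe′≡--βe′ (trans (cong negˢ (lookup-neg β e′)) (negˢ-involutive _))

      classification : ∀ {γ} → L γ → γ ≡ z ⊎ γ ≡ β ⊎ γ ≡ neg β
      classification {γ} γ∈L with covectors γ γ∈L
      ... | X , Sγ with support-cases γ Sγ
      ...   | inj₁ γ≡z = inj₁ γ≡z
      ...   | inj₂ refl = inj₂ (top-covectors γ∈L Sγ)

      β≢-β : β ≢ neg β
      β≢-β β≡-β = Γ-∅-nonempty λ e e∈Γ → Supp-≢neg β β-supp e∈Γ β≡-β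

      bottom-unique : ∀ γ → Supp F γ X → IsBottomFlat F X → γ ≡ z
      bottom-unique γ Sγ (_ , X≤) with support-cases γ Sγ
      ... | inj₁ γ≡z = γ≡z
      ... | inj₂ refl = ⊥-elim (nonempty⇒≢∅ A₀-nonempty (FlatLe-from-top (X≤ A₀ fA₀)))

      z≤top : ∀ γ → Supp F γ ∅ → CovLe F z γ
      z≤top _ Sγ = A₀ , ∅ , z-supp , Sγ , FlatLe-top fA₀ , λ _ e∈Γ _ → ⊥-elim (Γ-A₀-empty e∈Γ)

      ¬top≤z : ∀ γ → Supp F γ ∅ → ¬ CovLe F γ z
      ¬top≤z γ Sγ (X , Y , SγX , SzY , X≤Y , _) with support-cases γ SγX
      ... | inj₁ γ≡z = Supp-∅⇒≢z γ Sγ γ≡z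
      ... | inj₂ refl = Supp-∅⇒≢z z (subst (Supp F z) (FlatLe-from-top X≤Y) SzY) refl

      ¬top≤top : ∀ γ δ → Supp F γ ∅ → Supp F δ ∅ → (∀ {e} → Γ ∅ e → lookup γ e ≢ lookup δ e)
        → ¬ CovLe F γ δ
      ¬top≤top γ δ Sγ Sδ differ (X , Y , SγX , SδY , _ , agree)
        with support-cases γ SγX | support-cases δ SδY
      ... | inj₁ γ≡z | _ = Supp-∅⇒≢z γ Sγ γ≡z
      ... | inj₂ _ | inj₁ δ≡z = Supp-∅⇒≢z δ Sδ δ≡z
      ... | inj₂ refl | inj₂ refl = Γ-∅-nonempty λ e e∈Γ → differ e∈Γ (agree e e∈Γ e∈Γ)

      β-opposite : Γ ∅ e → lookup β e ≢ lookup (neg β) e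
      β-opposite {e} e∈Γ βe≡-βe = IsPM⇒≢negˢ (Supp-Γ β β-supp e∈Γ) (trans βe≡-βe (lookup-neg β e))

open Greedoid

mainTheorem16 : ∀ {n : ℕ} (F : Family n) (L : SignVec n → Set)
    → IsOrientedIntervalGreedoid F L
    → RankOne F
    → ∃[ z ] ∃[ β ] (L z × L β × L (neg β)
        × (∀ γ → L γ → (γ ≡ z) ⊎ (γ ≡ β) ⊎ (γ ≡ neg β))
        × z ≢ β × z ≢ neg β × β ≢ neg β
        × (∃[ X ] (Supp F z X × IsBottomFlat F X))
        × (∀ γ X → L γ → Supp F γ X → IsBottomFlat F X → γ ≡ z)
        × CovLe F z β × CovLe F z (neg β)
        × ¬ CovLe F β z × ¬ CovLe F (neg β) z
        × ¬ CovLe F β (neg β) × ¬ CovLe F (neg β) β)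
mainTheorem16 F L OG (_ , _ , fA₀ , fA₁ , A₀≤A₁ , A₀≉A₁ , maximal) =
    z , β , z∈L , β∈L , OG2 β β∈L
  , (λ _ → classification)
  , Supp-∅⇒≢z β β-supp ∘ sym , Supp-∅⇒≢z (neg β) -β-supp ∘ sym , β≢-β
  , (_ , z-supp , A₀-bottom)
  , (λ γ _ _ → bottom-unique γ)
  , z≤top β β-supp , z≤top (neg β) -β-supp
  , ¬top≤z β β-supp , ¬top≤z (neg β) -β-supp
  , ¬top≤top β (neg β) β-supp -β-supp β-opposite
  , ¬top≤top (neg β) β -β-supp β-supp (λ e∈Γ → β-opposite e∈Γ ∘ sym)
  where
  open IsOrientedIntervalGreedoid OG
  open RankOneFlats F greedoid fA₀ fA₁ A₀≤A₁ A₀≉A₁ maximal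
  open Covectors OG
  -β-supp : Supp F (neg β) ∅
  -β-supp = Supp-neg F β β-supp
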